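{- Let $m$ be a positive integer, $C\in\mathbb{F}_{2^m}$, $D\in\mathbb{F}_{2^{2m}}$, and $\lambda\in\mathbb{F}_{2^{2m}}$ with $\lambda^{2^m+1}=1$. Consider the triple of maps $\mathbb{F}_{2^{4m}}\to\mathbb{F}_{2^{4m}}$ $$(\Phi_1,\Phi_2,\Phi_3)=\left(\lambda x^{2^m},\ \lambda x^{2^{3m}},\ Cx+Dx^{2^m}+(C+1)x^{2^{2m}}+Dx^{2^{3m}}\right).$$ Then $\Phi_1,\Phi_2,\Phi_3$ are permutations of $\mathbb{F}_{2^{4m}}$, the triple satisfies property $(\mathcal{A}_{4m})$, and $E^{\cup}\neq\mathbb{F}_{2^{4m}}$.
   Context: For a positive integer $n$ and $q=2^n$, three permutations $\Phi_1,\Phi_2,\Phi_3$ of $\mathbb{F}_q$ are said to satisfy property $(\mathcal{A}_n)$ if (1) $\Psi=\Phi_1+\Phi_2+\Phi_3$ is a permutation of $\mathbb{F}_q$, and (2) $\Psi^{ -1}=\Phi_1^{ -1}+\Phi_2^{ -1}+\Phi_3^{ -1}$ (sums are pointwise sums of functions, inverses are compositional inverses). For $1\le i<j\le 3$, $E_{i,j}=\{x\in\mathbb{F}_q:\Phi_i(x)=\Phi_j(x)\}$ and $E^{\cup}=E_{1,2}\cup E_{1,3}\cup E_{2,3}$. -}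

module Defs where

open import Level using (0ℓ)
open import Data.Nat using (ℕ; zero; suc)
open import Data.Fin using (Fin)
open import Data.Product using (Σ; _×_; _,_; ∃)
open import Relation.Binary.PropositionalEquality using (_≡_)
open import Relation.Nullary using (¬_)
open import Algebra.Structures using (IsCommutativeRing)
open import Function.Bundles using (_↔_)

record Field : Set₁ where
  infixl 6 _+_
  infixl 7 _*_
  field
    Carrier : Set
    _+_ _*_ : Carrier → Carrier → Carrier
    -_ : Carrier → Carrier
    0# 1# : Carrier
    isCommutativeRing : IsCommutativeRing _≡_ _+_ _*_ -_ 0# 1#
    0≢1 : ¬ (0# ≡ 1#)
    inverse : ∀ x → ¬ (x ≡ 0#) → Σ Carrier λ y → x * y ≡ 1#

  _^ᶠ_ : Carrier → ℕ → Carrier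
  x ^ᶠ zero  = 1#
  x ^ᶠ suc n = x * (x ^ᶠ n)

-- A finite field with exactly q elements (a model of 𝔽_q; unique up to isomorphism).
record FiniteField (q : ℕ) : Set₁ where
  field
    field′ : Field
  open Field field′ public
  field
    enum : Fin q ↔ Carrier

IsInversePair : {A : Set} → (A → A) → (A → A) → Set
IsInversePair {A} f g = (∀ x → g (f x) ≡ x) × (∀ y → f (g y) ≡ y)

module _ {q : ℕ} (F : FiniteField q) where
  open FiniteField F

  -- Property (A_n) for a triple of maps on F (with q = 2^n):
  -- Φ1, Φ2, Φ3 are permutations (witnessed by their inverses), Ψ = Φ1+Φ2+Φ3 is
  -- a permutation, and Ψ⁻¹ = Φ1⁻¹ + Φ2⁻¹ + Φ3⁻¹.
  PropertyA : (Carrier → Carrier) → (Carrier → Carrier) → (Carrier → Carrier) → Set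
  PropertyA Φ₁ Φ₂ Φ₃ =
    Σ (Carrier → Carrier) λ ι₁ → Σ (Carrier → Carrier) λ ι₂ → Σ (Carrier → Carrier) λ ι₃ →
      IsInversePair Φ₁ ι₁ × IsInversePair Φ₂ ι₂ × IsInversePair Φ₃ ι₃ ×
      IsInversePair (λ x → Φ₁ x + Φ₂ x + Φ₃ x) (λ y → ι₁ y + ι₂ y + ι₃ y)

  NotInEUnion : (Carrier → Carrier) → (Carrier → Carrier) → (Carrier → Carrier) → Carrier → Set
  NotInEUnion Φ₁ Φ₂ Φ₃ x = ¬ (Φ₁ x ≡ Φ₂ x) × ¬ (Φ₁ x ≡ Φ₃ x) × ¬ (Φ₂ x ≡ Φ₃ x)

  EUnionProper : (Carrier → Carrier) → (Carrier → Carrier) → (Carrier → Carrier) → Set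
  EUnionProper Φ₁ Φ₂ Φ₃ = ∃ λ x → NotInEUnion Φ₁ Φ₂ Φ₃ x

-- The Frobenius power σ x = x^(2^m) is a ring endomorphism of F = 𝔽_(2^4m) with σ⁴ = id, since
-- x^|F| = x for every x (and |F| even forces characteristic 2). All maps involved are σ-linear,
-- L a x = a₀x + a₁σx + a₂σ²x + a₃σ³x, and σ ∘ L a = L (σa₃, σa₀, σa₁, σa₂).
-- As λσ(λ) = 1, Φ₁ = λσ and Φ₂ = λσ³ are mutually inverse, while Φ₃ and Ψ = Φ₁ + Φ₂ + Φ₃ both have
-- the shape L (c, t, c + 1, t) with σc = c and σ²t = t, which is an involution in characteristic 2.
-- Hence Ψ⁻¹ = Ψ = Φ₂ + Φ₁ + Φ₃ = Φ₁⁻¹ + Φ₂⁻¹ + Φ₃⁻¹.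
-- If two of the Φᵢ agree at x, then x is a root of P = X + λX^(2^m) + X^(2^2m) + λX^(2^3m): for
-- Φᵢ x = Φ₃ x apply y ↦ y + σ²y to Φᵢ x + Φ₃ x = 0, and for Φ₁ x = Φ₂ x cancel λ to get σ²x = x.
-- But P has degree 2^3m < |F| and leading coefficient λ ≠ 0, so some x ∈ F is not a root.

module Submission where

open import Defs
open import Data.Nat using (ℕ)
import Data.Nat as N
open import Data.Product using (_×_)
open import Relation.Binary.PropositionalEquality using (_≡_)

open import Level using (0ℓ)
open import Data.Nat using (zero; suc; s≤s; z≤n)
import Data.Nat.Properties as NP
open import Data.Bool using (Bool; true; false)
open import Data.Bool.Properties using (xor-∧-commutativeRing)
open import Data.Maybe using (Maybe; just; nothing)
open import Data.Empty using (⊥-elim)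
open import Data.Fin using (Fin)
import Data.Fin as Fin
open import Data.Fin.Properties using (¬Fin0; inj⇒≟; punchInᵢ≢i)
import Data.Fin.Permutation as Perm
open import Data.Vec.Functional using (removeAt)
open import Data.List using (List; []; _∷_; _++_; replicate; length; tabulate)
open import Data.List.Properties using (length-tabulate)
open import Data.List.Relation.Unary.All as All using (All; []; _∷_; all?)
open import Data.List.Relation.Unary.All.Properties.Core using (¬All⇒Any¬)
open import Data.List.Relation.Unary.AllPairs using (_∷_)
open import Data.List.Relation.Unary.Any using (satisfied)
open import Data.List.Relation.Unary.Unique.Propositional using (Unique)
open import Data.List.Relation.Unary.Unique.Propositional.Properties using (tabulate⁺)
open import Data.Product using (∃; _,_; proj₁; proj₂; swap; map₂)
open import Function.Base using (_∘_)
open import Function.Bundles using (Inverse; Injection; _↔_)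
open import Function.Properties.Inverse using (↔⇒↣; ↔-sym)
open import Relation.Binary.PropositionalEquality
  using (refl; sym; trans; cong; cong₂; subst; _≗_; module ≡-Reasoning)
open import Relation.Binary.Definitions using (DecidableEquality)
open import Relation.Nullary using (¬_; yes; no)
open import Algebra.Bundles using (CommutativeRing)
open import Algebra.Solver.Ring.AlmostCommutativeRing using (_-Raw-AlmostCommutative⟶_; fromCommutativeRing)
import Algebra.Solver.Ring as RingSolver
import Algebra.Properties.Ring as RingProperties
import Algebra.Properties.CommutativeMonoid.Sum as MonoidSum

module FieldTheory (F : Field) where
  open Field F

  commutativeRing : CommutativeRing 0ℓ 0ℓ
  commutativeRing = record { isCommutativeRing = isCommutativeRing }

  open CommutativeRing commutativeRing public
    using (_-_; +-identityˡ; +-identityʳ; +-comm; +-assoc; -‿inverseˡ;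
           *-identityˡ; *-identityʳ; *-comm; *-assoc; zeroˡ; zeroʳ; semiring; commutativeSemiring; *-commutativeMonoid)
  open import Algebra.Properties.Semiring.Exp semiring using (_^_; ^-homo-*; ^-assocʳ)
  open import Algebra.Properties.CommutativeSemiring.Exp commutativeSemiring using (^-distrib-*)
  open ≡-Reasoning

  module _ {x : Carrier} (x≢0 : ¬ x ≡ 0#) where
    x⁻¹ : Carrier
    x⁻¹ = proj₁ (inverse x x≢0)

    x⁻¹*[x*y]≡y : ∀ y → x⁻¹ * (x * y) ≡ y
    x⁻¹*[x*y]≡y y = begin
      x⁻¹ * (x * y)  ≡⟨ sym (*-assoc x⁻¹ x y) ⟩
      (x⁻¹ * x) * y  ≡⟨ cong (_* y) (trans (*-comm x⁻¹ x) (proj₂ (inverse x x≢0))) ⟩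
      1# * y         ≡⟨ *-identityˡ y ⟩
      y              ∎

    x*[x⁻¹*y]≡y : ∀ y → x * (x⁻¹ * y) ≡ y
    x*[x⁻¹*y]≡y y = begin
      x * (x⁻¹ * y)  ≡⟨ sym (*-assoc x x⁻¹ y) ⟩
      (x * x⁻¹) * y  ≡⟨ cong (_* y) (proj₂ (inverse x x≢0)) ⟩
      1# * y         ≡⟨ *-identityˡ y ⟩
      y              ∎

  *-cancelˡ : ∀ {x y z} → ¬ x ≡ 0# → x * y ≡ x * z → y ≡ z
  *-cancelˡ {x} {y} {z} x≢0 xy≡xz = begin
    y                  ≡⟨ sym (x⁻¹*[x*y]≡y x≢0 y) ⟩
    x⁻¹ x≢0 * (x * y)  ≡⟨ cong (x⁻¹ x≢0 *_) xy≡xz ⟩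
    x⁻¹ x≢0 * (x * z)  ≡⟨ x⁻¹*[x*y]≡y x≢0 z ⟩
    z                  ∎

  x*y≡0⇒y≡0 : ∀ {x y} → ¬ x ≡ 0# → x * y ≡ 0# → y ≡ 0#
  x*y≡0⇒y≡0 {x} x≢0 xy≡0 = *-cancelˡ x≢0 (trans xy≡0 (sym (zeroʳ x)))

  *-nonzero : ∀ {x y} → ¬ x ≡ 0# → ¬ y ≡ 0# → ¬ x * y ≡ 0#
  *-nonzero x≢0 y≢0 xy≡0 = y≢0 (x*y≡0⇒y≡0 x≢0 xy≡0)

  ^ᶠ≡^ : ∀ x n → x ^ᶠ n ≡ x ^ n
  ^ᶠ≡^ x zero    = refl
  ^ᶠ≡^ x (suc n) = cong (x *_) (^ᶠ≡^ x n)

  ^ᶠ-homo-* : ∀ x m n → x ^ᶠ (m N.+ n) ≡ x ^ᶠ m * x ^ᶠ n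
  ^ᶠ-homo-* x m n rewrite ^ᶠ≡^ x (m N.+ n) | ^ᶠ≡^ x m | ^ᶠ≡^ x n = ^-homo-* x m n

  ^ᶠ-assocʳ : ∀ x m n → (x ^ᶠ m) ^ᶠ n ≡ x ^ᶠ (m N.* n)
  ^ᶠ-assocʳ x m n rewrite ^ᶠ≡^ (x ^ᶠ m) n | ^ᶠ≡^ x m | ^ᶠ≡^ x (m N.* n) = ^-assocʳ x m n

  ^ᶠ-distrib-* : ∀ x y n → (x * y) ^ᶠ n ≡ x ^ᶠ n * y ^ᶠ n
  ^ᶠ-distrib-* x y n rewrite ^ᶠ≡^ (x * y) n | ^ᶠ≡^ x n | ^ᶠ≡^ y n = ^-distrib-* x y n

  1^ᶠ : ∀ n → 1# ^ᶠ n ≡ 1#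
  1^ᶠ zero    = refl
  1^ᶠ (suc n) = trans (*-identityˡ _) (1^ᶠ n)

module LittleFermat (F : Field) where
  open Field F
  open FieldTheory F
  open MonoidSum *-commutativeMonoid
    using (sum-cong-≗; sum-permute; sum-remove; ∑-distrib-+) renaming (sum to ∏)
  open ≡-Reasoning

  ∏-nonzero : ∀ {n} (t : Fin n → Carrier) → (∀ i → ¬ t i ≡ 0#) → ¬ ∏ t ≡ 0#
  ∏-nonzero {zero}  t t≢0 ∏≡0 = 0≢1 (sym ∏≡0)
  ∏-nonzero {suc n} t t≢0 = *-nonzero (t≢0 Fin.zero) (∏-nonzero (t ∘ Fin.suc) (t≢0 ∘ Fin.suc))

  ∏-const : ∀ n x → ∏ {n} (λ _ → x) ≡ x ^ᶠ n
  ∏-const zero    x = refl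
  ∏-const (suc n) x = cong (x *_) (∏-const n x)

  module Units {n : ℕ} (enum : Fin (suc n) ↔ Carrier) where
    open Inverse enum using () renaming (to to element; from to index)

    _≟_ : DecidableEquality Carrier
    _≟_ = inj⇒≟ (↔⇒↣ (↔-sym enum))

    -- 0 is replaced by 1, so that the product of unit over all of F is the product of F*.
    unit : Carrier → Carrier
    unit y with y ≟ 0#
    ... | yes _ = 1#
    ... | no  _ = y

    unit-0 : unit 0# ≡ 1#
    unit-0 with 0# ≟ 0#
    ... | yes _   = refl
    ... | no 0≢0 = ⊥-elim (0≢0 refl)

    unit-≢0 : ∀ {y} → ¬ y ≡ 0# → unit y ≡ y
    unit-≢0 {y} y≢0 with y ≟ 0#
    ... | yes y≡0 = ⊥-elim (y≢0 y≡0)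
    ... | no  _   = refl

    unit-nonzero : ∀ y → ¬ unit y ≡ 0#
    unit-nonzero y with y ≟ 0#
    ... | yes _   = λ 1≡0 → 0≢1 (sym 1≡0)
    ... | no  y≢0 = y≢0

    ∏units : Carrier
    ∏units = ∏ (λ i → unit (element i))

    module _ {x : Carrier} (x≢0 : ¬ x ≡ 0#) where
      scaling-permutation : Perm.Permutation (suc n) (suc n)
      scaling-permutation = Perm.permutation
        (λ i → index (x * element i)) (λ i → index (x⁻¹ x≢0 * element i))
        (λ i → trans (cong (λ y → index (x * y)) (Inverse.strictlyInverseˡ enum _))
                     (trans (cong index (x*[x⁻¹*y]≡y x≢0 _)) (Inverse.strictlyInverseʳ enum i)))
        (λ i → trans (cong (λ y → index (x⁻¹ x≢0 * y)) (Inverse.strictlyInverseˡ enum _))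
                     (trans (cong index (x⁻¹*[x*y]≡y x≢0 _)) (Inverse.strictlyInverseʳ enum i)))

      ∏unit[x*e]≡∏units : ∏ (λ i → unit (x * element i)) ≡ ∏units
      ∏unit[x*e]≡∏units = sym (trans (sum-permute (λ i → unit (element i)) scaling-permutation)
        (sum-cong-≗ {suc n} (λ i → cong unit (Inverse.strictlyInverseˡ enum (x * element i)))))

      ∏[x*unit]≡x^q*∏units : ∏ (λ i → x * unit (element i)) ≡ x ^ᶠ suc n * ∏units
      ∏[x*unit]≡x^q*∏units = trans (∑-distrib-+ (λ _ → x) (λ i → unit (element i)))
                                   (cong (_* ∏units) (∏-const (suc n) x))

      -- The two products differ only at the index of 0, where the factors are x and 1.
      ∏[x*unit]≡x*∏unit[x*e] : ∏ (λ i → x * unit (element i)) ≡ x * ∏ (λ i → unit (x * element i))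
      ∏[x*unit]≡x*∏unit[x*e] = begin
        ∏ b                          ≡⟨ sum-remove {i = i₀} b ⟩
        b i₀ * ∏ (removeAt b i₀)     ≡⟨ cong₂ _*_ b₀ (sum-cong-≗ agree) ⟩
        x * ∏ (removeAt a i₀)        ≡⟨ cong (x *_) (sym (*-identityˡ _)) ⟩
        x * (1# * ∏ (removeAt a i₀)) ≡⟨ cong (λ y → x * (y * ∏ (removeAt a i₀))) (sym a₀) ⟩
        x * (a i₀ * ∏ (removeAt a i₀)) ≡⟨ cong (x *_) (sym (sum-remove {i = i₀} a)) ⟩
        x * ∏ a                      ∎
        where
        a b : Fin (suc n) → Carrier
        a i = unit (x * element i)
        b i = x * unit (element i)
        i₀ = index 0#
        element-i₀ : element i₀ ≡ 0#
        element-i₀ = Inverse.strictlyInverseˡ enum 0#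
        a₀ : a i₀ ≡ 1#
        a₀ = trans (cong unit (trans (cong (x *_) element-i₀) (zeroʳ x))) unit-0
        b₀ : b i₀ ≡ x
        b₀ = trans (cong (λ y → x * unit y) element-i₀) (trans (cong (x *_) unit-0) (*-identityʳ x))
        agree : ∀ j → removeAt b i₀ j ≡ removeAt a i₀ j
        agree j = trans (cong (x *_) (unit-≢0 y≢0)) (sym (unit-≢0 (*-nonzero x≢0 y≢0)))
          where
          y≢0 : ¬ element (Fin.punchIn i₀ j) ≡ 0#
          y≢0 y≡0 = punchInᵢ≢i i₀ j (trans (sym (Inverse.strictlyInverseʳ enum _)) (cong index y≡0))

      ^ᶠ-card-nonzero : x ^ᶠ suc n ≡ x
      ^ᶠ-card-nonzero = *-cancelˡ (∏-nonzero _ (λ i → unit-nonzero (element i))) (begin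
        ∏units * x ^ᶠ suc n                  ≡⟨ *-comm ∏units _ ⟩
        x ^ᶠ suc n * ∏units                  ≡⟨ sym ∏[x*unit]≡x^q*∏units ⟩
        ∏ (λ i → x * unit (element i))       ≡⟨ ∏[x*unit]≡x*∏unit[x*e] ⟩
        x * ∏ (λ i → unit (x * element i))   ≡⟨ cong (x *_) ∏unit[x*e]≡∏units ⟩
        x * ∏units                           ≡⟨ *-comm x ∏units ⟩
        ∏units * x                           ∎)

  ^ᶠ-card : ∀ {k} → Fin k ↔ Carrier → ∀ x → x ^ᶠ k ≡ x
  ^ᶠ-card {zero}  enum x = ⊥-elim (¬Fin0 (Inverse.from enum x))
  ^ᶠ-card {suc n} enum x with Units._≟_ enum x 0#
  ... | yes refl = zeroˡ _
  ... | no  x≢0  = Units.^ᶠ-card-nonzero enum x≢0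

module Polynomials (F : Field) where
  open Field F
  open FieldTheory F
  open RingProperties (CommutativeRing.ring commutativeRing) using (x∙y⁻¹≈ε⇒x≈y)
  open import Algebra.Solver.Ring.NaturalCoefficients.Default commutativeSemiring
  open ≡-Reasoning

  -- Polynomials are coefficient lists, constant term first; lastOr 0# gives the leading coefficient.
  eval : List Carrier → Carrier → Carrier
  eval []       x = 0#
  eval (c ∷ cs) x = c + x * eval cs x

  lastOr : Carrier → List Carrier → Carrier
  lastOr d []       = d
  lastOr d (c ∷ cs) = lastOr c cs

  monomial : ℕ → Carrier → List Carrier
  monomial k c = replicate k 0# ++ c ∷ []

  infixl 6 _⊕_
  _⊕_ : List Carrier → List Carrier → List Carrier
  []       ⊕ qs       = qs
  (a ∷ ps) ⊕ []       = a ∷ ps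
  (a ∷ ps) ⊕ (b ∷ qs) = (a + b) ∷ (ps ⊕ qs)

  eval-⊕ : ∀ ps qs x → eval (ps ⊕ qs) x ≡ eval ps x + eval qs x
  eval-⊕ []       qs       x = sym (+-identityˡ _)
  eval-⊕ (a ∷ ps) []       x = sym (+-identityʳ _)
  eval-⊕ (a ∷ ps) (b ∷ qs) x = begin
    (a + b) + x * eval (ps ⊕ qs) x            ≡⟨ cong (λ e → (a + b) + x * e) (eval-⊕ ps qs x) ⟩
    (a + b) + x * (eval ps x + eval qs x)     ≡⟨ solve 5 (λ a b x p q → (a :+ b) :+ x :* (p :+ q)
                                                   := (a :+ x :* p) :+ (b :+ x :* q)) refl a b x (eval ps x) (eval qs x) ⟩
    (a + x * eval ps x) + (b + x * eval qs x) ∎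

  eval-monomial : ∀ k c x → eval (monomial k c) x ≡ c * x ^ᶠ k
  eval-monomial zero    c x = solve 2 (λ c x → c :+ x :* con 0 := c :* con 1) refl c x
  eval-monomial (suc k) c x = begin
    0# + x * eval (monomial k c) x  ≡⟨ cong (λ e → 0# + x * e) (eval-monomial k c x) ⟩
    0# + x * (c * x ^ᶠ k)           ≡⟨ solve 3 (λ c x y → con 0 :+ x :* (c :* y) := c :* (x :* y)) refl c x (x ^ᶠ k) ⟩
    c * (x * x ^ᶠ k)                ∎

  length-monomial : ∀ k c → length (monomial k c) ≡ suc k
  length-monomial zero    c = refl
  length-monomial (suc k) c = cong suc (length-monomial k c)

  lastOr-monomial : ∀ d k c → lastOr d (monomial k c) ≡ c
  lastOr-monomial d zero    c = refl
  lastOr-monomial d (suc k) c = lastOr-monomial 0# k c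

  length-⊕ : ∀ ps qs → length ps N.< length qs → length (ps ⊕ qs) ≡ length qs
  length-⊕ []       qs       _              = refl
  length-⊕ (a ∷ ps) (b ∷ qs) (N.s≤s ps<qs) = cong suc (length-⊕ ps qs ps<qs)

  lastOr-⊕ : ∀ d e ps qs → length ps N.< length qs → lastOr d (ps ⊕ qs) ≡ lastOr e qs
  lastOr-⊕ d e []       (b ∷ qs) _              = refl
  lastOr-⊕ d e (a ∷ ps) (b ∷ qs) (N.s≤s ps<qs) = lastOr-⊕ (a + b) b ps qs ps<qs

  quotient : List Carrier → Carrier → List Carrier
  quotient []           a = []
  quotient (c ∷ [])     a = []
  quotient (c ∷ d ∷ cs) a = eval (d ∷ cs) a ∷ quotient (d ∷ cs) a

  x-a+a≡x : ∀ x a → (x - a) + a ≡ x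
  x-a+a≡x x a = begin
    (x - a) + a    ≡⟨ +-assoc x (- a) a ⟩
    x + (- a + a)  ≡⟨ cong (x +_) (-‿inverseˡ a) ⟩
    x + 0#         ≡⟨ +-identityʳ x ⟩
    x              ∎

  eval-quotient : ∀ ps a x → eval ps x ≡ (x - a) * eval (quotient ps a) x + eval ps a
  eval-quotient []           a x = solve 1 (λ y → con 0 := y :* con 0 :+ con 0) refl (x - a)
  eval-quotient (c ∷ [])     a x =
    solve 4 (λ c x a y → c :+ x :* con 0 := y :* con 0 :+ (c :+ a :* con 0)) refl c x a (x - a)
  eval-quotient (c ∷ d ∷ cs) a x = begin
    c + x * eval (d ∷ cs) x           ≡⟨ cong (λ e → c + x * e) (eval-quotient (d ∷ cs) a x) ⟩
    c + x * ((x - a) * Q + r)         ≡⟨ cong (λ z → c + z * ((x - a) * Q + r)) (sym (x-a+a≡x x a)) ⟩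
    c + ((x - a) + a) * ((x - a) * Q + r)
      ≡⟨ solve 5 (λ c a y Q r → c :+ (y :+ a) :* (y :* Q :+ r) := y :* (r :+ (y :+ a) :* Q) :+ (c :+ a :* r))
               refl c a (x - a) Q r ⟩
    (x - a) * (r + ((x - a) + a) * Q) + (c + a * r)
      ≡⟨ cong (λ z → (x - a) * (r + z * Q) + (c + a * r)) (x-a+a≡x x a) ⟩
    (x - a) * (r + x * Q) + (c + a * r) ∎
    where
    Q = eval (quotient (d ∷ cs) a) x
    r = eval (d ∷ cs) a

  length-quotient : ∀ c cs a → length (quotient (c ∷ cs) a) ≡ length cs
  length-quotient c []       a = refl
  length-quotient c (d ∷ cs) a = cong suc (length-quotient d cs a)

  lastOr-quotient : ∀ e c d cs a → lastOr e (quotient (c ∷ d ∷ cs) a) ≡ lastOr d cs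
  lastOr-quotient e c d []        a = solve 2 (λ d a → d :+ a :* con 0 := d) refl d a
  lastOr-quotient e c d (d′ ∷ cs) a = lastOr-quotient e d d′ cs a

  quotient-root : ∀ ps a b → eval ps a ≡ 0# → ¬ a ≡ b → eval ps b ≡ 0# → eval (quotient ps a) b ≡ 0#
  quotient-root ps a b pa≡0 a≢b pb≡0 = x*y≡0⇒y≡0 b-a≢0 (begin
    (b - a) * eval (quotient ps a) b            ≡⟨ sym (+-identityʳ _) ⟩
    (b - a) * eval (quotient ps a) b + 0#       ≡⟨ cong ((b - a) * eval (quotient ps a) b +_) (sym pa≡0) ⟩
    (b - a) * eval (quotient ps a) b + eval ps a ≡⟨ sym (eval-quotient ps a b) ⟩
    eval ps b                                   ≡⟨ pb≡0 ⟩
    0#                                          ∎)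
    where
    b-a≢0 : ¬ b - a ≡ 0#
    b-a≢0 b-a≡0 = a≢b (sym (x∙y⁻¹≈ε⇒x≈y b a b-a≡0))

  roots-bound : ∀ ps xs → ¬ lastOr 0# ps ≡ 0# → Unique xs → All (λ x → eval ps x ≡ 0#) xs →
                length xs N.< length ps
  roots-bound []           xs       lead≢0 _ _ = ⊥-elim (lead≢0 refl)
  roots-bound (c ∷ cs)     []       _      _ _ = N.s≤s N.z≤n
  roots-bound (c ∷ [])     (a ∷ _)  lead≢0 _ (ca≡0 ∷ _) =
    ⊥-elim (lead≢0 (trans (solve 2 (λ c a → c := c :+ a :* con 0) refl c a) ca≡0))
  roots-bound (c ∷ d ∷ cs) (a ∷ as) lead≢0 (a∉as ∷ as-unique) (pa≡0 ∷ pas≡0) =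
    N.s≤s (subst (length as N.<_) (length-quotient c (d ∷ cs) a)
      (roots-bound (quotient (c ∷ d ∷ cs) a) as
        (λ lead≡0 → lead≢0 (trans (sym (lastOr-quotient 0# c d cs a)) lead≡0))
        as-unique
        (All.zipWith (λ {b} (a≢b , pb≡0) → quotient-root (c ∷ d ∷ cs) a b pa≡0 a≢b pb≡0) (a∉as , pas≡0))))

  length-⊕-monomial : ∀ ps k c → length ps N.≤ k → length (ps ⊕ monomial k c) ≡ suc k
  length-⊕-monomial ps k c ps≤k = trans
    (length-⊕ ps (monomial k c) (subst (length ps N.<_) (sym (length-monomial k c)) (N.s≤s ps≤k)))
    (length-monomial k c)

  length-⊕-monomial≤ : ∀ ps k c {k′} → length ps N.≤ k → k N.< k′ → length (ps ⊕ monomial k c) N.≤ k′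
  length-⊕-monomial≤ ps k c {k′} ps≤k k<k′ = subst (N._≤ k′) (sym (length-⊕-monomial ps k c ps≤k)) k<k′

  lastOr-⊕-monomial : ∀ d ps k c → length ps N.≤ k → lastOr d (ps ⊕ monomial k c) ≡ c
  lastOr-⊕-monomial d ps k c ps≤k = trans
    (lastOr-⊕ d 0# ps (monomial k c) (subst (length ps N.<_) (sym (length-monomial k c)) (N.s≤s ps≤k)))
    (lastOr-monomial 0# k c)

module FiniteFieldTheory {q : ℕ} (F : FiniteField q) where
  open FiniteField F
  open FieldTheory field′
  open Polynomials field′
  open LittleFermat field′ using (^ᶠ-card)
  open ≡-Reasoning

  open RingProperties (CommutativeRing.ring commutativeRing) using (-1*x≈-x; -‿involutive)

  fermat : ∀ x → x ^ᶠ q ≡ x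
  fermat = ^ᶠ-card enum

  characteristic-two : ∀ k → q ≡ 2 N.* k → 1# + 1# ≡ 0#
  characteristic-two k q≡2k = begin
    1# + 1#          ≡⟨ cong (_+ 1#) (sym -1≡1) ⟩
    - 1# + 1#        ≡⟨ -‿inverseˡ 1# ⟩
    0#               ∎
    where
    -1≡1 : - 1# ≡ 1#
    -1≡1 = begin
      - 1#                   ≡⟨ sym (fermat (- 1#)) ⟩
      (- 1#) ^ᶠ q            ≡⟨ cong ((- 1#) ^ᶠ_) q≡2k ⟩
      (- 1#) ^ᶠ (2 N.* k)    ≡⟨ sym (^ᶠ-assocʳ (- 1#) 2 k) ⟩
      ((- 1#) ^ᶠ 2) ^ᶠ k     ≡⟨ cong (_^ᶠ k) (trans (cong (- 1# *_) (*-identityʳ (- 1#)))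
                                                    (trans (-1*x≈-x (- 1#)) (-‿involutive 1#))) ⟩
      1# ^ᶠ k                ≡⟨ 1^ᶠ k ⟩
      1#                     ∎

  _≟_ : DecidableEquality Carrier
  _≟_ = inj⇒≟ (↔⇒↣ (↔-sym enum))

  elements : List Carrier
  elements = tabulate (Inverse.to enum)

  elements-unique : Unique elements
  elements-unique = tabulate⁺ (Injection.injective (↔⇒↣ enum))

  non-root : ∀ ps → ¬ lastOr 0# ps ≡ 0# → length ps N.≤ q → ∃ λ x → ¬ eval ps x ≡ 0#
  non-root ps lead≢0 ps≤q with all? (λ x → eval ps x ≟ 0#) elements
  ... | no ¬all-roots = satisfied (¬All⇒Any¬ (λ x → eval ps x ≟ 0#) elements ¬all-roots)
  ... | yes all-roots = ⊥-elim (NP.<⇒≱ (roots-bound ps elements lead≢0 elements-unique all-roots)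
                                        (subst (length ps N.≤_) (sym (length-tabulate _)) ps≤q))

HasCharacteristic2 : Field → Set
HasCharacteristic2 F = 1# + 1# ≡ 0#
  where open Field F

module Characteristic2 (F : Field) (1+1≡0 : HasCharacteristic2 F) where
  open Field F
  open FieldTheory F
  open RingProperties (CommutativeRing.ring commutativeRing) using (-0#≈0#)
  open ≡-Reasoning

  -1≡1 : - 1# ≡ 1#
  -1≡1 = begin
    - 1#               ≡⟨ sym (+-identityʳ (- 1#)) ⟩
    - 1# + 0#          ≡⟨ cong (- 1# +_) (sym 1+1≡0) ⟩
    - 1# + (1# + 1#)   ≡⟨ sym (+-assoc (- 1#) 1# 1#) ⟩
    (- 1# + 1#) + 1#   ≡⟨ cong (_+ 1#) (-‿inverseˡ 1#) ⟩
    0# + 1#            ≡⟨ +-identityˡ 1# ⟩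
    1#                 ∎

  ⟦_⟧𝔽₂ : Bool → Carrier
  ⟦ true  ⟧𝔽₂ = 1#
  ⟦ false ⟧𝔽₂ = 0#

  𝔽₂-homomorphism : CommutativeRing.rawRing xor-∧-commutativeRing
                      -Raw-AlmostCommutative⟶ fromCommutativeRing commutativeRing
  𝔽₂-homomorphism = record
    { ⟦_⟧    = ⟦_⟧𝔽₂
    ; +-homo = λ { false false → sym (+-identityʳ 0#) ; false true → sym (+-identityˡ 1#)
                 ; true false → sym (+-identityʳ 1#) ; true true → sym 1+1≡0 }
    ; *-homo = λ { false false → sym (zeroʳ 0#) ; false true → sym (zeroˡ 1#)
                 ; true false → sym (zeroʳ 1#) ; true true → sym (*-identityʳ 1#) }
    ; -‿homo = λ { false → sym -0#≈0# ; true → sym -1≡1 }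
    ; 0-homo = refl
    ; 1-homo = refl
    }

  𝔽₂-equal? : ∀ a b → Maybe (⟦ a ⟧𝔽₂ ≡ ⟦ b ⟧𝔽₂)
  𝔽₂-equal? false false = just refl
  𝔽₂-equal? true  true  = just refl
  𝔽₂-equal? _     _     = nothing

  -- The ring solver with coefficients in 𝔽₂ = (Bool, xor, ∧), so that it also proves x + x = 0.
  open RingSolver (CommutativeRing.rawRing xor-∧-commutativeRing) (fromCommutativeRing commutativeRing)
    𝔽₂-homomorphism 𝔽₂-equal? public

  x+x≡0 : ∀ x → x + x ≡ 0#
  x+x≡0 = solve 1 (λ x → x :+ x := con false) refl

  frobenius-+ : ∀ k x y → (x + y) ^ᶠ (2 N.^ k) ≡ x ^ᶠ (2 N.^ k) + y ^ᶠ (2 N.^ k)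
  frobenius-+ zero    x y = solve 2 (λ x y → (x :+ y) :* con true := x :* con true :+ y :* con true) refl x y
  frobenius-+ (suc k) x y = begin
    (x + y) ^ᶠ (2 N.* 2 N.^ k)             ≡⟨ sym (^ᶠ-assocʳ (x + y) 2 (2 N.^ k)) ⟩
    ((x + y) ^ᶠ 2) ^ᶠ (2 N.^ k)            ≡⟨ cong (_^ᶠ (2 N.^ k)) (square-+ x y) ⟩
    (x ^ᶠ 2 + y ^ᶠ 2) ^ᶠ (2 N.^ k)         ≡⟨ frobenius-+ k (x ^ᶠ 2) (y ^ᶠ 2) ⟩
    (x ^ᶠ 2) ^ᶠ (2 N.^ k) + (y ^ᶠ 2) ^ᶠ (2 N.^ k)
      ≡⟨ cong₂ _+_ (^ᶠ-assocʳ x 2 (2 N.^ k)) (^ᶠ-assocʳ y 2 (2 N.^ k)) ⟩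
    x ^ᶠ (2 N.* 2 N.^ k) + y ^ᶠ (2 N.* 2 N.^ k) ∎
    where
    square-+ : ∀ x y → (x + y) ^ᶠ 2 ≡ x ^ᶠ 2 + y ^ᶠ 2
    square-+ = solve 2 (λ x y → (x :+ y) :* ((x :+ y) :* con true)
                              := x :* (x :* con true) :+ y :* (y :* con true)) refl

record Period4Automorphism (F : Field) : Set where
  open Field F
  field
    σ      : Carrier → Carrier
    σ-+    : ∀ x y → σ (x + y) ≡ σ x + σ y
    σ-*    : ∀ x y → σ (x * y) ≡ σ x * σ y
    σ-1    : σ 1# ≡ 1#
    σ⁴≡id  : ∀ x → σ (σ (σ (σ x))) ≡ x

module TwistedLinearMaps (F : Field) (1+1≡0 : HasCharacteristic2 F) (automorphism : Period4Automorphism F) where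
  open Field F
  open Period4Automorphism automorphism
  open FieldTheory F
  open Characteristic2 F 1+1≡0
  open ≡-Reasoning

  σ² σ³ : Carrier → Carrier
  σ² x = σ (σ x)
  σ³ x = σ (σ² x)

  σ-0 : σ 0# ≡ 0#
  σ-0 = begin
    σ 0#              ≡⟨ cong σ (sym 1+1≡0) ⟩
    σ (1# + 1#)       ≡⟨ σ-+ 1# 1# ⟩
    σ 1# + σ 1#       ≡⟨ cong₂ _+_ σ-1 σ-1 ⟩
    1# + 1#           ≡⟨ 1+1≡0 ⟩
    0#                ∎

  σ-+1 : ∀ {c} → σ c ≡ c → σ (c + 1#) ≡ c + 1#
  σ-+1 {c} σc≡c = trans (σ-+ c 1#) (cong₂ _+_ σc≡c σ-1)

  σ²-fixed : ∀ {c} → σ c ≡ c → σ² c ≡ c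
  σ²-fixed σc≡c = trans (cong σ σc≡c) σc≡c

  σ³-from-σ² : ∀ {c} → σ² c ≡ c → σ³ c ≡ σ c
  σ³-from-σ² σ²c≡c = cong σ σ²c≡c

  L : Carrier → Carrier → Carrier → Carrier → Carrier → Carrier
  L a₀ a₁ a₂ a₃ x = a₀ * x + a₁ * σ x + a₂ * σ² x + a₃ * σ³ x

  L-cong : ∀ {a₀ a₁ a₂ a₃ b₀ b₁ b₂ b₃} x → a₀ ≡ b₀ → a₁ ≡ b₁ → a₂ ≡ b₂ → a₃ ≡ b₃ →
           L a₀ a₁ a₂ a₃ x ≡ L b₀ b₁ b₂ b₃ x
  L-cong x refl refl refl refl = refl

  σ-L : ∀ a₀ a₁ a₂ a₃ x → σ (L a₀ a₁ a₂ a₃ x) ≡ L (σ a₃) (σ a₀) (σ a₁) (σ a₂) x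
  σ-L a₀ a₁ a₂ a₃ x = begin
    σ (a₀ * x + a₁ * σ x + a₂ * σ² x + a₃ * σ³ x)
      ≡⟨ trans (σ-+ _ _) (cong (_+ σ (a₃ * σ³ x)) (trans (σ-+ _ _) (cong (_+ σ (a₂ * σ² x)) (σ-+ _ _)))) ⟩
    σ (a₀ * x) + σ (a₁ * σ x) + σ (a₂ * σ² x) + σ (a₃ * σ³ x)
      ≡⟨ cong₂ _+_ (cong₂ _+_ (cong₂ _+_ (σ-* a₀ x) (σ-* a₁ (σ x))) (σ-* a₂ (σ² x)))
                   (trans (σ-* a₃ (σ³ x)) (cong (σ a₃ *_) (σ⁴≡id x))) ⟩
    σ a₀ * σ x + σ a₁ * σ² x + σ a₂ * σ³ x + σ a₃ * x
      ≡⟨ solve 8 (λ b₀ b₁ b₂ b₃ y₀ y₁ y₂ y₃ → b₀ :* y₁ :+ b₁ :* y₂ :+ b₂ :* y₃ :+ b₃ :* y₀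
                   := b₃ :* y₀ :+ b₀ :* y₁ :+ b₁ :* y₂ :+ b₂ :* y₃)
           refl (σ a₀) (σ a₁) (σ a₂) (σ a₃) x (σ x) (σ² x) (σ³ x) ⟩
    L (σ a₃) (σ a₀) (σ a₁) (σ a₂) x ∎

  σ²-L : ∀ a₀ a₁ a₂ a₃ x → σ² (L a₀ a₁ a₂ a₃ x) ≡ L (σ² a₂) (σ² a₃) (σ² a₀) (σ² a₁) x
  σ²-L a₀ a₁ a₂ a₃ x = trans (cong σ (σ-L a₀ a₁ a₂ a₃ x)) (σ-L _ _ _ _ x)

  L-involutive : ∀ {c t} → σ c ≡ c → σ² t ≡ t → ∀ x → L c t (c + 1#) t (L c t (c + 1#) t x) ≡ x
  L-involutive {c} {t} σc≡c σ²t≡t x = begin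
    c * y + t * σ y + (c + 1#) * σ² y + t * σ³ y
      ≡⟨ cong₂ _+_ (cong₂ _+_ (cong (λ z → c * y + t * z) σy) (cong ((c + 1#) *_) σ²y)) (cong (t *_) σ³y) ⟩
    c * y + t * L (σ t) c (σ t) (c + 1#) x + (c + 1#) * L (c + 1#) t c t x + t * L (σ t) (c + 1#) (σ t) c x
      ≡⟨ solve 7 (λ c t σt x₀ x₁ x₂ x₃ →
           c :* (c :* x₀ :+ t :* x₁ :+ (c :+ con true) :* x₂ :+ t :* x₃)
           :+ t :* (σt :* x₀ :+ c :* x₁ :+ σt :* x₂ :+ (c :+ con true) :* x₃)
           :+ (c :+ con true) :* ((c :+ con true) :* x₀ :+ t :* x₁ :+ c :* x₂ :+ t :* x₃)
           :+ t :* (σt :* x₀ :+ (c :+ con true) :* x₁ :+ σt :* x₂ :+ c :* x₃) := x₀)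
           refl c t (σ t) x (σ x) (σ² x) (σ³ x) ⟩
    x ∎
    where
    y = L c t (c + 1#) t x
    σy : σ y ≡ L (σ t) c (σ t) (c + 1#) x
    σy = trans (σ-L _ _ _ _ x) (L-cong x refl σc≡c refl (σ-+1 σc≡c))
    σ²y : σ² y ≡ L (c + 1#) t c t x
    σ²y = trans (σ²-L _ _ _ _ x) (L-cong x (σ²-fixed (σ-+1 σc≡c)) σ²t≡t (σ²-fixed σc≡c) σ²t≡t)
    σ³y : σ³ y ≡ L (σ t) (c + 1#) (σ t) c x
    σ³y = trans (cong σ σ²y) (trans (σ-L _ _ _ _ x) (L-cong x refl (σ-+1 σc≡c) refl σc≡c))

  σ²-* : ∀ x y → σ² (x * y) ≡ σ² x * σ² y
  σ²-* x y = trans (cong σ (σ-* x y)) (σ-* (σ x) (σ y))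

  σ³-* : ∀ x y → σ³ (x * y) ≡ σ³ x * σ³ y
  σ³-* x y = trans (cong σ (σ²-* x y)) (σ-* (σ² x) (σ² y))

  σ²-0 : σ² 0# ≡ 0#
  σ²-0 = σ²-fixed σ-0

  L-root⇒symmetrised-root : ∀ {a₀ a₁ a₂ a₃ x} → σ² a₀ ≡ a₀ → σ² a₁ ≡ a₁ → σ² a₂ ≡ a₂ → σ² a₃ ≡ a₃ →
    L a₀ a₁ a₂ a₃ x ≡ 0# → L (a₀ + a₂) (a₁ + a₃) (a₂ + a₀) (a₃ + a₁) x ≡ 0#
  L-root⇒symmetrised-root {a₀} {a₁} {a₂} {a₃} {x} h₀ h₁ h₂ h₃ root = begin
    L (a₀ + a₂) (a₁ + a₃) (a₂ + a₀) (a₃ + a₁) x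
      ≡⟨ solve 8 (λ a₀ a₁ a₂ a₃ x₀ x₁ x₂ x₃ →
           (a₀ :+ a₂) :* x₀ :+ (a₁ :+ a₃) :* x₁ :+ (a₂ :+ a₀) :* x₂ :+ (a₃ :+ a₁) :* x₃
           := (a₀ :* x₀ :+ a₁ :* x₁ :+ a₂ :* x₂ :+ a₃ :* x₃) :+ (a₂ :* x₀ :+ a₃ :* x₁ :+ a₀ :* x₂ :+ a₁ :* x₃))
           refl a₀ a₁ a₂ a₃ x (σ x) (σ² x) (σ³ x) ⟩
    L a₀ a₁ a₂ a₃ x + L a₂ a₃ a₀ a₁ x
      ≡⟨ cong (L a₀ a₁ a₂ a₃ x +_) (sym (trans (σ²-L a₀ a₁ a₂ a₃ x) (L-cong x h₂ h₃ h₀ h₁))) ⟩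
    L a₀ a₁ a₂ a₃ x + σ² (L a₀ a₁ a₂ a₃ x)
      ≡⟨ cong (λ y → y + σ² y) root ⟩
    0# + σ² 0#
      ≡⟨ trans (+-identityˡ _) σ²-0 ⟩
    0# ∎

  module Triple {C D λ′ : Carrier}
    (σC≡C : σ C ≡ C) (σ²D≡D : σ² D ≡ D) (σ²λ′≡λ′ : σ² λ′ ≡ λ′) (λ′σλ′≡1 : λ′ * σ λ′ ≡ 1#) where

    Φ₁ Φ₂ Φ₃ Ψ P : Carrier → Carrier
    Φ₁ x = λ′ * σ x
    Φ₂ x = λ′ * σ³ x
    Φ₃   = L C D (C + 1#) D
    Ψ x  = Φ₁ x + Φ₂ x + Φ₃ x
    P    = L 1# λ′ 1# λ′

    λ′≢0 : ¬ λ′ ≡ 0#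
    λ′≢0 λ′≡0 = 0≢1 (trans (sym (zeroˡ (σ λ′))) (trans (cong (_* σ λ′) (sym λ′≡0)) λ′σλ′≡1))

    λ′*[σλ′*x]≡x : ∀ x → λ′ * (σ λ′ * x) ≡ x
    λ′*[σλ′*x]≡x x = trans (sym (*-assoc λ′ (σ λ′) x)) (trans (cong (_* x) λ′σλ′≡1) (*-identityˡ x))

    Φ₁-Φ₂-inverse : IsInversePair Φ₁ Φ₂
    Φ₁-Φ₂-inverse = Φ₂∘Φ₁ , Φ₁∘Φ₂
      where
      Φ₂∘Φ₁ : ∀ x → Φ₂ (Φ₁ x) ≡ x
      Φ₂∘Φ₁ x = trans (cong (λ′ *_) (trans (σ³-* λ′ (σ x)) (cong₂ _*_ (σ³-from-σ² σ²λ′≡λ′) (σ⁴≡id x))))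
                      (λ′*[σλ′*x]≡x x)
      Φ₁∘Φ₂ : ∀ x → Φ₁ (Φ₂ x) ≡ x
      Φ₁∘Φ₂ x = trans (cong (λ′ *_) (trans (σ-* λ′ (σ³ x)) (cong (σ λ′ *_) (σ⁴≡id x))))
                      (λ′*[σλ′*x]≡x x)

    Φ₃-involutive : IsInversePair Φ₃ Φ₃
    Φ₃-involutive = L-involutive σC≡C σ²D≡D , L-involutive σC≡C σ²D≡D

    σ²[λ′+D]≡λ′+D : σ² (λ′ + D) ≡ λ′ + D
    σ²[λ′+D]≡λ′+D = trans (cong σ (σ-+ λ′ D)) (trans (σ-+ (σ λ′) (σ D)) (cong₂ _+_ σ²λ′≡λ′ σ²D≡D))

    Ψ≗L : ∀ x → Ψ x ≡ L C (λ′ + D) (C + 1#) (λ′ + D) x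
    Ψ≗L x = solve 7 (λ l c d x₀ x₁ x₂ x₃ →
        l :* x₁ :+ l :* x₃ :+ (c :* x₀ :+ d :* x₁ :+ (c :+ con true) :* x₂ :+ d :* x₃)
        := c :* x₀ :+ (l :+ d) :* x₁ :+ (c :+ con true) :* x₂ :+ (l :+ d) :* x₃)
      refl λ′ C D x (σ x) (σ² x) (σ³ x)

    Ψ-involutive : IsInversePair Ψ Ψ
    Ψ-involutive = Ψ∘Ψ , Ψ∘Ψ
      where
      Ψ∘Ψ : ∀ x → Ψ (Ψ x) ≡ x
      Ψ∘Ψ x = begin
        Ψ (Ψ x)                        ≡⟨ Ψ≗L (Ψ x) ⟩
        L C (λ′ + D) (C + 1#) (λ′ + D) (Ψ x) ≡⟨ cong (L C (λ′ + D) (C + 1#) (λ′ + D)) (Ψ≗L x) ⟩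
        L C (λ′ + D) (C + 1#) (λ′ + D) (L C (λ′ + D) (C + 1#) (λ′ + D) x)
                                       ≡⟨ L-involutive σC≡C σ²[λ′+D]≡λ′+D x ⟩
        x                              ∎

    σ²C≡C : σ² C ≡ C
    σ²C≡C = σ²-fixed σC≡C

    σ²[C+1]≡C+1 : σ² (C + 1#) ≡ C + 1#
    σ²[C+1]≡C+1 = σ²-fixed (σ-+1 σC≡C)

    Φ₁≡Φ₃⇒P≡0 : ∀ {x} → Φ₁ x ≡ Φ₃ x → P x ≡ 0#
    Φ₁≡Φ₃⇒P≡0 {x} Φ₁x≡Φ₃x = begin
      P x ≡⟨ solve 7 (λ l c d x₀ x₁ x₂ x₃ →
               con true :* x₀ :+ l :* x₁ :+ con true :* x₂ :+ l :* x₃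
               := (c :+ (c :+ con true)) :* x₀ :+ ((l :+ d) :+ d) :* x₁
                  :+ ((c :+ con true) :+ c) :* x₂ :+ (d :+ (l :+ d)) :* x₃)
             refl λ′ C D x (σ x) (σ² x) (σ³ x) ⟩
      L (C + (C + 1#)) ((λ′ + D) + D) ((C + 1#) + C) (D + (λ′ + D)) x
          ≡⟨ L-root⇒symmetrised-root σ²C≡C σ²[λ′+D]≡λ′+D σ²[C+1]≡C+1 σ²D≡D root ⟩
      0# ∎
      where
      root : L C (λ′ + D) (C + 1#) D x ≡ 0#
      root = begin
        L C (λ′ + D) (C + 1#) D x ≡⟨ solve 7 (λ l c d x₀ x₁ x₂ x₃ →
                                        c :* x₀ :+ (l :+ d) :* x₁ :+ (c :+ con true) :* x₂ :+ d :* x₃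
                                        := l :* x₁ :+ (c :* x₀ :+ d :* x₁ :+ (c :+ con true) :* x₂ :+ d :* x₃))
                                      refl λ′ C D x (σ x) (σ² x) (σ³ x) ⟩
        Φ₁ x + Φ₃ x               ≡⟨ cong (_+ Φ₃ x) Φ₁x≡Φ₃x ⟩
        Φ₃ x + Φ₃ x               ≡⟨ x+x≡0 (Φ₃ x) ⟩
        0#                        ∎

    Φ₂≡Φ₃⇒P≡0 : ∀ {x} → Φ₂ x ≡ Φ₃ x → P x ≡ 0#
    Φ₂≡Φ₃⇒P≡0 {x} Φ₂x≡Φ₃x = begin
      P x ≡⟨ solve 7 (λ l c d x₀ x₁ x₂ x₃ →
               con true :* x₀ :+ l :* x₁ :+ con true :* x₂ :+ l :* x₃
               := (c :+ (c :+ con true)) :* x₀ :+ (d :+ (l :+ d)) :* x₁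
                  :+ ((c :+ con true) :+ c) :* x₂ :+ ((l :+ d) :+ d) :* x₃)
             refl λ′ C D x (σ x) (σ² x) (σ³ x) ⟩
      L (C + (C + 1#)) (D + (λ′ + D)) ((C + 1#) + C) ((λ′ + D) + D) x
          ≡⟨ L-root⇒symmetrised-root σ²C≡C σ²D≡D σ²[C+1]≡C+1 σ²[λ′+D]≡λ′+D root ⟩
      0# ∎
      where
      root : L C D (C + 1#) (λ′ + D) x ≡ 0#
      root = begin
        L C D (C + 1#) (λ′ + D) x ≡⟨ solve 7 (λ l c d x₀ x₁ x₂ x₃ →
                                        c :* x₀ :+ d :* x₁ :+ (c :+ con true) :* x₂ :+ (l :+ d) :* x₃
                                        := l :* x₃ :+ (c :* x₀ :+ d :* x₁ :+ (c :+ con true) :* x₂ :+ d :* x₃))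
                                      refl λ′ C D x (σ x) (σ² x) (σ³ x) ⟩
        Φ₂ x + Φ₃ x               ≡⟨ cong (_+ Φ₃ x) Φ₂x≡Φ₃x ⟩
        Φ₃ x + Φ₃ x               ≡⟨ x+x≡0 (Φ₃ x) ⟩
        0#                        ∎

    Φ₁≡Φ₂⇒P≡0 : ∀ {x} → Φ₁ x ≡ Φ₂ x → P x ≡ 0#
    Φ₁≡Φ₂⇒P≡0 {x} Φ₁x≡Φ₂x = begin
      1# * x + λ′ * σ x + 1# * σ² x + λ′ * σ³ x
        ≡⟨ cong₂ (λ u v → 1# * x + λ′ * σ x + 1# * u + λ′ * v) σ²x≡x (sym σx≡σ³x) ⟩
      1# * x + λ′ * σ x + 1# * x + λ′ * σ x
        ≡⟨ solve 3 (λ l x₀ x₁ → con true :* x₀ :+ l :* x₁ :+ con true :* x₀ :+ l :* x₁ := con false)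
             refl λ′ x (σ x) ⟩
      0# ∎
      where
      σx≡σ³x : σ x ≡ σ³ x
      σx≡σ³x = *-cancelˡ λ′≢0 Φ₁x≡Φ₂x
      σ²x≡x : σ² x ≡ x
      σ²x≡x = trans (sym (σ⁴≡id (σ² x))) (trans (cong σ³ (sym σx≡σ³x)) (σ⁴≡id x))

IsInversePair-resp-≗ : {A : Set} {f f′ g g′ : A → A} → f ≗ f′ → g ≗ g′ →
                       IsInversePair f g → IsInversePair f′ g′
IsInversePair-resp-≗ {f = f} {g′ = g′} f≗f′ g≗g′ (g∘f≗id , f∘g≗id) =
  (λ x → trans (cong g′ (sym (f≗f′ x))) (trans (sym (g≗g′ _)) (g∘f≗id x))) ,
  (λ y → trans (sym (f≗f′ _)) (trans (cong f (sym (g≗g′ y))) (f∘g≗id y)))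

module _ {q : ℕ} (F : FiniteField q) where
  open FiniteField F
  open FieldTheory field′

  PropertyA-resp-≗ : ∀ {Φ₁ Φ₂ Φ₃ Φ₁′ Φ₂′ Φ₃′ : Carrier → Carrier} → Φ₁ ≗ Φ₁′ → Φ₂ ≗ Φ₂′ → Φ₃ ≗ Φ₃′ →
                     PropertyA F Φ₁ Φ₂ Φ₃ → PropertyA F Φ₁′ Φ₂′ Φ₃′
  PropertyA-resp-≗ Φ₁≗ Φ₂≗ Φ₃≗ (ι₁ , ι₂ , ι₃ , inverse₁ , inverse₂ , inverse₃ , inverseΨ) =
    ι₁ , ι₂ , ι₃ ,
    IsInversePair-resp-≗ Φ₁≗ (λ _ → refl) inverse₁ ,
    IsInversePair-resp-≗ Φ₂≗ (λ _ → refl) inverse₂ ,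
    IsInversePair-resp-≗ Φ₃≗ (λ _ → refl) inverse₃ ,
    IsInversePair-resp-≗ (λ x → cong₂ _+_ (cong₂ _+_ (Φ₁≗ x) (Φ₂≗ x)) (Φ₃≗ x)) (λ _ → refl) inverseΨ

  EUnionProper-resp-≗ : ∀ {Φ₁ Φ₂ Φ₃ Φ₁′ Φ₂′ Φ₃′ : Carrier → Carrier} → Φ₁ ≗ Φ₁′ → Φ₂ ≗ Φ₂′ → Φ₃ ≗ Φ₃′ →
                        EUnionProper F Φ₁ Φ₂ Φ₃ → EUnionProper F Φ₁′ Φ₂′ Φ₃′
  EUnionProper-resp-≗ Φ₁≗ Φ₂≗ Φ₃≗ (x , Φ₁≢Φ₂ , Φ₁≢Φ₃ , Φ₂≢Φ₃) =
    x , (λ eq → Φ₁≢Φ₂ (trans (Φ₁≗ x) (trans eq (sym (Φ₂≗ x))))) ,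
        (λ eq → Φ₁≢Φ₃ (trans (Φ₁≗ x) (trans eq (sym (Φ₃≗ x))))) ,
        (λ eq → Φ₂≢Φ₃ (trans (Φ₂≗ x) (trans eq (sym (Φ₃≗ x)))))

  PropertyA-of-involutive-sum : ∀ {Φ₁ Φ₂ Φ₃ : Carrier → Carrier} →
    IsInversePair Φ₁ Φ₂ → IsInversePair Φ₃ Φ₃ →
    IsInversePair (λ x → Φ₁ x + Φ₂ x + Φ₃ x) (λ x → Φ₁ x + Φ₂ x + Φ₃ x) →
    PropertyA F Φ₁ Φ₂ Φ₃
  PropertyA-of-involutive-sum {Φ₁} {Φ₂} {Φ₃} inverse₁₂ inverse₃ inverseΨ =
    Φ₂ , Φ₁ , Φ₃ , inverse₁₂ , swap inverse₁₂ , inverse₃ ,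
    IsInversePair-resp-≗ (λ _ → refl) (λ y → cong (_+ Φ₃ y) (+-comm (Φ₁ y) (Φ₂ y))) inverseΨ

module FrobeniusOfOrder4 (m₀ : ℕ) (F : FiniteField (2 N.^ (4 N.* suc m₀))) where
  open FiniteField F
  open FieldTheory field′
  open Polynomials field′
  open FiniteFieldTheory F
  open ≡-Reasoning

  m : ℕ
  m = suc m₀

  -- 2 ^ (4 * suc m₀) reduces to 2 * 2 ^ (m₀ + 3 * m).
  1+1≡0 : 1# + 1# ≡ 0#
  1+1≡0 = characteristic-two (2 N.^ (m₀ N.+ 3 N.* m)) refl

  open Characteristic2 field′ 1+1≡0 using (frobenius-+)

  σ : Carrier → Carrier
  σ x = x ^ᶠ (2 N.^ m)

  σ-^ᶠ : ∀ {k n} → m N.+ k ≡ n → ∀ x → σ (x ^ᶠ (2 N.^ k)) ≡ x ^ᶠ (2 N.^ n)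
  σ-^ᶠ {k} {n} m+k≡n x = begin
    (x ^ᶠ (2 N.^ k)) ^ᶠ (2 N.^ m)   ≡⟨ ^ᶠ-assocʳ x (2 N.^ k) (2 N.^ m) ⟩
    x ^ᶠ (2 N.^ k N.* 2 N.^ m)      ≡⟨ cong (x ^ᶠ_) (sym (NP.^-distribˡ-+-* 2 k m)) ⟩
    x ^ᶠ (2 N.^ (k N.+ m))          ≡⟨ cong (λ e → x ^ᶠ (2 N.^ e)) (trans (NP.+-comm k m) m+k≡n) ⟩
    x ^ᶠ (2 N.^ n)                  ∎

  σ²≡^ᶠ : ∀ x → σ (σ x) ≡ x ^ᶠ (2 N.^ (2 N.* m))
  σ²≡^ᶠ = σ-^ᶠ (cong (m N.+_) (sym (NP.+-identityʳ m)))

  σ³≡^ᶠ : ∀ x → σ (σ (σ x)) ≡ x ^ᶠ (2 N.^ (3 N.* m))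
  σ³≡^ᶠ x = trans (cong σ (σ²≡^ᶠ x)) (σ-^ᶠ refl x)

  σ⁴≡id : ∀ x → σ (σ (σ (σ x))) ≡ x
  σ⁴≡id x = trans (cong σ (σ³≡^ᶠ x)) (trans (σ-^ᶠ refl x) (fermat x))

  x^[2^m+1]≡x*σx : ∀ x → x ^ᶠ (2 N.^ m N.+ 1) ≡ x * σ x
  x^[2^m+1]≡x*σx x = begin
    x ^ᶠ (2 N.^ m N.+ 1)  ≡⟨ ^ᶠ-homo-* x (2 N.^ m) 1 ⟩
    σ x * (x * 1#)        ≡⟨ cong (σ x *_) (*-identityʳ x) ⟩
    σ x * x               ≡⟨ *-comm (σ x) x ⟩
    x * σ x               ∎

  frobenius : Period4Automorphism field′
  frobenius = record
    { σ     = σ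
    ; σ-+   = frobenius-+ m
    ; σ-*   = λ x y → ^ᶠ-distrib-* x y (2 N.^ m)
    ; σ-1   = 1^ᶠ (2 N.^ m)
    ; σ⁴≡id = σ⁴≡id
    }

  open TwistedLinearMaps field′ 1+1≡0 frobenius public

  lowerTerms Lpolynomial : Carrier → List Carrier
  lowerTerms λ′  = monomial 1 1# ⊕ monomial (2 N.^ m) λ′ ⊕ monomial (2 N.^ (2 N.* m)) 1#
  Lpolynomial λ′ = lowerTerms λ′ ⊕ monomial (2 N.^ (3 N.* m)) λ′

  eval-Lpolynomial : ∀ λ′ x → eval (Lpolynomial λ′) x ≡ L 1# λ′ 1# λ′ x
  eval-Lpolynomial λ′ x = begin
    eval (m₁ ⊕ m₂ ⊕ m₃ ⊕ m₄) x
      ≡⟨ trans (eval-⊕ (m₁ ⊕ m₂ ⊕ m₃) m₄ x)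
               (cong (_+ eval m₄ x) (trans (eval-⊕ (m₁ ⊕ m₂) m₃ x) (cong (_+ eval m₃ x) (eval-⊕ m₁ m₂ x)))) ⟩
    eval m₁ x + eval m₂ x + eval m₃ x + eval m₄ x
      ≡⟨ cong₂ _+_ (cong₂ _+_ (cong₂ _+_ (eval-monomial 1 1# x) (eval-monomial (2 N.^ m) λ′ x))
                                          (eval-monomial (2 N.^ (2 N.* m)) 1# x))
                   (eval-monomial (2 N.^ (3 N.* m)) λ′ x) ⟩
    1# * (x * 1#) + λ′ * σ x + 1# * x ^ᶠ (2 N.^ (2 N.* m)) + λ′ * x ^ᶠ (2 N.^ (3 N.* m))
      ≡⟨ cong₂ _+_ (cong₂ _+_ (cong (λ y → 1# * y + λ′ * σ x) (*-identityʳ x))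
                              (cong (1# *_) (sym (σ²≡^ᶠ x))))
                   (cong (λ′ *_) (sym (σ³≡^ᶠ x))) ⟩
    L 1# λ′ 1# λ′ x ∎
    where
    m₁ = monomial 1 1#
    m₂ = monomial (2 N.^ m) λ′
    m₃ = monomial (2 N.^ (2 N.* m)) 1#
    m₄ = monomial (2 N.^ (3 N.* m)) λ′

  2^k*m<2^[m+k*m] : ∀ k → 2 N.^ (k N.* m) N.< 2 N.^ (m N.+ k N.* m)
  2^k*m<2^[m+k*m] k = NP.^-monoʳ-< 2 (s≤s (s≤s z≤n)) {k N.* m} {m N.+ k N.* m} (NP.m<n+m (k N.* m) (s≤s z≤n))

  length-lowerTerms : ∀ λ′ → length (lowerTerms λ′) N.≤ 2 N.^ (3 N.* m)
  length-lowerTerms λ′ =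
    length-⊕-monomial≤ (monomial 1 1# ⊕ monomial (2 N.^ m) λ′) (2 N.^ (2 N.* m)) 1#
      (length-⊕-monomial≤ (monomial 1 1#) (2 N.^ m) λ′ 2≤2^m 2^m<2^[2m]) (2^k*m<2^[m+k*m] 2)
    where
    2≤2^m : 2 N.≤ 2 N.^ m
    2≤2^m = NP.^-monoʳ-< 2 (s≤s (s≤s z≤n)) {0} {m} (s≤s z≤n)
    2^m<2^[2m] : 2 N.^ m N.< 2 N.^ (2 N.* m)
    2^m<2^[2m] = subst (λ k → 2 N.^ k N.< 2 N.^ (2 N.* m)) (NP.+-identityʳ m) (2^k*m<2^[m+k*m] 1)

  L-non-root : ∀ {λ′} → ¬ λ′ ≡ 0# → ∃ λ x → ¬ L 1# λ′ 1# λ′ x ≡ 0#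
  L-non-root {λ′} λ′≢0 =
    map₂ (λ {x} Px≢0 Lx≡0 → Px≢0 (trans (eval-Lpolynomial λ′ x) Lx≡0))
         (non-root (Lpolynomial λ′) lead≢0
           (length-⊕-monomial≤ (lowerTerms λ′) (2 N.^ (3 N.* m)) λ′ (length-lowerTerms λ′) (2^k*m<2^[m+k*m] 3)))
    where
    lead≢0 : ¬ lastOr 0# (Lpolynomial λ′) ≡ 0#
    lead≢0 lead≡0 = λ′≢0 (trans (sym (lastOr-⊕-monomial 0# (lowerTerms λ′) _ λ′ (length-lowerTerms λ′))) lead≡0)

mainTheorem8 : (m : ℕ) → m N.≥ 1 → (F : FiniteField (2 N.^ (4 N.* m))) →
    let open FiniteField F in
    (C D λ' : Carrier) →
    C ^ᶠ (2 N.^ m) ≡ C →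
    D ^ᶠ (2 N.^ (2 N.* m)) ≡ D →
    λ' ^ᶠ (2 N.^ (2 N.* m)) ≡ λ' →
    λ' ^ᶠ (2 N.^ m N.+ 1) ≡ 1# →
    PropertyA F (λ x → λ' * (x ^ᶠ (2 N.^ m))) (λ x → λ' * (x ^ᶠ (2 N.^ (3 N.* m))))
      (λ x → C * x + D * (x ^ᶠ (2 N.^ m)) + (C + 1#) * (x ^ᶠ (2 N.^ (2 N.* m)))
               + D * (x ^ᶠ (2 N.^ (3 N.* m))))
    × EUnionProper F (λ x → λ' * (x ^ᶠ (2 N.^ m))) (λ x → λ' * (x ^ᶠ (2 N.^ (3 N.* m))))
      (λ x → C * x + D * (x ^ᶠ (2 N.^ m)) + (C + 1#) * (x ^ᶠ (2 N.^ (2 N.* m)))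
               + D * (x ^ᶠ (2 N.^ (3 N.* m))))
mainTheorem8 (suc m₀) (s≤s z≤n) F C D λ′ σC≡C D^≡D λ′^≡λ′ λ′^[2^m+1]≡1 =
  PropertyA-resp-≗ F (λ _ → refl) Φ₂≗ Φ₃≗
    (PropertyA-of-involutive-sum F Φ₁-Φ₂-inverse Φ₃-involutive Ψ-involutive) ,
  EUnionProper-resp-≗ F (λ _ → refl) Φ₂≗ Φ₃≗
    (x , Px≢0 ∘ Φ₁≡Φ₂⇒P≡0 , Px≢0 ∘ Φ₁≡Φ₃⇒P≡0 , Px≢0 ∘ Φ₂≡Φ₃⇒P≡0)
  where
  open FiniteField F
  open FrobeniusOfOrder4 m₀ F
  open Triple σC≡C (trans (σ²≡^ᶠ D) D^≡D) (trans (σ²≡^ᶠ λ′) λ′^≡λ′)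
              (trans (sym (x^[2^m+1]≡x*σx λ′)) λ′^[2^m+1]≡1)
  Φ₂≗ : ∀ x → Φ₂ x ≡ λ′ * x ^ᶠ (2 N.^ (3 N.* m))
  Φ₂≗ x = cong (λ′ *_) (σ³≡^ᶠ x)
  Φ₃≗ : ∀ x → Φ₃ x ≡ C * x + D * σ x + (C + 1#) * x ^ᶠ (2 N.^ (2 N.* m)) + D * x ^ᶠ (2 N.^ (3 N.* m))
  Φ₃≗ x = cong₂ (λ u v → C * x + D * σ x + (C + 1#) * u + D * v) (σ²≡^ᶠ x) (σ³≡^ᶠ x)
  x = proj₁ (L-non-root λ′≢0)
  Px≢0 = proj₂ (L-non-root λ′≢0)
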